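{- Let $h$ be a positive integer and let $S$ be an additive abelian semigroup such that $r_{S,h}(x)$ is finite for all $x \in S$. Let $A$ be a subset of $S$ and let $(A_q)_{q=1}^{\infty}$ be a decreasing sequence of subsets of $S$ (i.e. $A_q \supseteq A_{q+1}$ for all $q$) such that $A = \bigcap_{q=1}^{\infty} A_q$. Then \[ hA = \bigcap_{q=1}^{\infty} hA_q. \]
   Context: For a subset $A$ of an additive abelian semigroup $S$ and a positive integer $h$, the $h$-fold sumset is $hA = \{a_1+\cdots+a_h : a_i \in A \text{ for all } i\}$. For $x \in S$, $r_{A,h}(x) = \#\{(a_1,\ldots,a_h) \in A^h : a_1+\cdots+a_h = x\}$; in particular $r_{S,h}(x)$ is the number of ordered $h$-tuples of elements of $S$ summing to $x$. -}

module Defs where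

open import Level using (Level; _⊔_)
open import Data.Nat using (ℕ; suc)
open import Data.Product using (∃; _×_)
open import Data.Vec using (Vec; []; _∷_)
open import Data.Vec.Relation.Unary.All using (All)
open import Data.List using (List)
open import Data.List.Membership.Propositional using (_∈_)
open import Relation.Binary.PropositionalEquality using (_≡_)
open import Relation.Unary using (Pred)
open import Algebra.Core using (Op₂)

module Sumsets {a : Level} {S : Set a} (_+_ : Op₂ S) where

  Σ⁺ : ∀ {k} → Vec S (suc k) → S
  Σ⁺ (x ∷ []) = x
  Σ⁺ (x ∷ y ∷ v) = x + Σ⁺ (y ∷ v)

  -- the h-fold sumset hA with h = suc k:
  -- x ∈ hA  iff  x = a₁ + ⋯ + aₕ with all aᵢ ∈ A
  sumset : ∀ {ℓ} (k : ℕ) → Pred S ℓ → Pred S (a ⊔ ℓ)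
  sumset k A x = ∃ λ (v : Vec S (suc k)) → All A v × Σ⁺ v ≡ x

  -- r_{S,h}(x) is finite (h = suc k): the ordered h-tuples of elements of S
  -- summing to x all occur in some finite list
  FiniteReps : (k : ℕ) → S → Set a
  FiniteReps k x = ∃ λ (L : List (Vec S (suc k))) → ∀ (v : Vec S (suc k)) → Σ⁺ v ≡ x → v ∈ L

{-# OPTIONS --safe #-}
module Submission where

-- If x lies in every hA_q, pick for each q a representation of x by a tuple from A_q.
-- Since x has only finitely many representations, some tuple w among them lies in
-- A_q^h for every q: a tuple that drops out at stage q₀ stays out at all later
-- stages, so it can be discarded and the argument repeated on the shorter list.
-- Then w is a tuple from ⋂ A_q = A, so x ∈ hA.  Excluded middle decides whether a
-- given tuple ever drops out.

open import Defs
open import Level using (Level; _⊔_)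
open import Function using (_∘_; id)
open import Data.Nat using (ℕ; suc; _+_; _≤_; _≤′_; ≤′-refl; ≤′-step)
open import Data.Nat.Properties using (≤⇒≤′; m≤m+n; m≤n+m)
open import Data.Product using (∃; _×_; _,_; proj₁; proj₂)
open import Data.Vec using (Vec)
open import Data.Vec.Relation.Unary.All as All using (All)
open import Data.Vec.Relation.Unary.All.Properties using (lookup⁺; lookup⁻)
open import Data.List using (List; []; _∷_)
open import Data.List.Relation.Unary.Any using (here; there)
open import Data.List.Membership.Propositional using (_∈_)
open import Relation.Nullary using (yes; no; ¬_; contradiction)
open import Relation.Nullary.Decidable using (decidable-stable)
open import Relation.Binary.PropositionalEquality using (_≡_; refl)
open import Relation.Unary using (Pred; _⊆_; _≐_; _∩_; ⋂)
open import Algebra.Core using (Op₂)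
open import Algebra.Structures using (IsCommutativeSemigroup)
open import Axiom.ExcludedMiddle using (ExcludedMiddle)

module _ {x p} {X : Set x} {P : ℕ → Pred X p} (antitone : ∀ q → P (suc q) ⊆ P q) where

  antitone-≤ : ∀ {m n} → m ≤ n → P n ⊆ P m
  antitone-≤ = go ∘ ≤⇒≤′
    where
    go : ∀ {m n} → m ≤′ n → P n ⊆ P m
    go ≤′-refl         = id
    go (≤′-step m≤′n) = go m≤′n ∘ antitone _

  listed-witnesses⇒∃⋂ : ExcludedMiddle p → (L : List X) →
                        (∀ q → ∃ λ v → v ∈ L × P q v) → ∃ (⋂ ℕ P)
  listed-witnesses⇒∃⋂ em [] witness with witness 0
  ... | _ , () , _
  listed-witnesses⇒∃⋂ em (w ∷ L) witness with em {∃ λ q → ¬ P q w}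
  ... | no w∈⋂ = w , λ q → decidable-stable em (λ w∉Pq → w∈⋂ (q , w∉Pq))
  ... | yes (q₀ , w∉Pq₀) = listed-witnesses⇒∃⋂ em L witness′
    where
    witness′ : ∀ q → ∃ λ v → v ∈ L × P q v
    witness′ q with witness (q₀ + q)
    ... | v , here refl , v∈P = contradiction (antitone-≤ (m≤m+n q₀ q) v∈P) w∉Pq₀
    ... | v , there v∈L , v∈P = v , v∈L , antitone-≤ (m≤n+m q q₀) v∈P

All-⋂ : ∀ {a ℓ} {S : Set a} {n} {As : ℕ → Pred S ℓ} {v : Vec S n} →
        (∀ q → All (As q) v) → All (⋂ ℕ As) v
All-⋂ v∈As = lookup⁻ (λ i q → lookup⁺ (v∈As q) i)

module _ {a} {S : Set a} (_+_ : Op₂ S) where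
  open Sumsets _+_

  sumset-mono : ∀ {ℓ₁ ℓ₂} {A : Pred S ℓ₁} {B : Pred S ℓ₂} (k : ℕ) →
                A ⊆ B → sumset k A ⊆ sumset k B
  sumset-mono k A⊆B (v , v∈A , Σv≡x) = v , All.map A⊆B v∈A , Σv≡x

  ⋂-sumset⊆sumset-⋂ : ∀ {ℓ} → ExcludedMiddle (a ⊔ ℓ) →
                      (k : ℕ) → (∀ x → FiniteReps k x) →
                      {As : ℕ → Pred S ℓ} → (∀ q → As (suc q) ⊆ As q) →
                      ⋂ ℕ (λ q → sumset k (As q)) ⊆ sumset k (⋂ ℕ As)
  ⋂-sumset⊆sumset-⋂ em k finite {As} antitone {x} x∈⋂ with finite x
  ... | reps , complete =
    let (v , v∈⋂) = listed-witnesses⇒∃⋂ represents-x-in-As-antitone em reps represented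
    in v , All-⋂ (proj₂ ∘ v∈⋂) , proj₁ (v∈⋂ 0)
    where
    RepresentsXIn : ℕ → Pred (Vec S (suc k)) _
    RepresentsXIn q = (λ v → Σ⁺ v ≡ x) ∩ All (As q)

    represents-x-in-As-antitone : ∀ q → RepresentsXIn (suc q) ⊆ RepresentsXIn q
    represents-x-in-As-antitone q (Σv≡x , v∈As) = Σv≡x , All.map (antitone q) v∈As

    represented : ∀ q → ∃ λ v → v ∈ reps × RepresentsXIn q v
    represented q = let (v , v∈As , Σv≡x) = x∈⋂ q in v , complete v Σv≡x , Σv≡x , v∈As

mainTheorem1 : ∀ {a ℓ : Level} → ExcludedMiddle (a ⊔ ℓ) →
    (S : Set a) (_+_ : Op₂ S) → IsCommutativeSemigroup _≡_ _+_ →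
    (k : ℕ) → (∀ x → Sumsets.FiniteReps _+_ k x) →
    (A : Pred S ℓ) (As : ℕ → Pred S ℓ) →
    (∀ q → As (suc q) ⊆ As q) →
    A ≐ ⋂ ℕ As →
    Sumsets.sumset _+_ k A ≐ ⋂ ℕ (λ q → Sumsets.sumset _+_ k (As q))
mainTheorem1 em S _+_ _ k finite A As antitone (A⊆⋂ , ⋂⊆A) =
    (λ x∈hA q → sumset-mono _+_ k (λ a∈A → A⊆⋂ a∈A q) x∈hA)
  , sumset-mono _+_ k ⋂⊆A ∘ ⋂-sumset⊆sumset-⋂ _+_ em k finite antitone
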